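{- Let $M$ and $N$ be matroids on disjoint finite sets $S$ and $T$, and let $A\subseteq S$, $B\subseteq T$. A subset $D$ of $S\cup T$ is a circuit of $(M,N;A,B)$ if and only if one of the following holds: (1) $D$ is a circuit of $M$; (2) $D$ is a circuit of $N$ and $D\subseteq T-B$; (3) $D=X\cup Y$ with $X\subseteq S$, $Y\subseteq T$, where (a) $X$ is independent in $M$ and no element of $X-A$ is a coloop of $M|(X\cup A)$, (b) $Y$ is a cyclic set of $N$ and $Y-B$ is independent in $N$, and (c) $|X|+|Y|-1=r_M(X\cup A)+r_N(Y)$.
   Context: A set in a matroid is cyclic if it is a (possibly empty) union of circuits. The principal sum $(M,N;A,B)$ is the matroid union $M^+(A,B)\vee N_0$, where: $N_0=N\oplus U_{0,S}$ ($N$ with the elements of $S$ added as loops); $M^+(A,B)$ is the matroid on $S\cup T$ obtained from $M$ by adding each element of $B$ freely (by successive principal extensions) to the flat $\mathrm{cl}_M(A)$ and each element of $T-B$ as a loop, equivalently the matroid with rank function $r(X\cup Y)=\min\{r_M(X\cup A),\,r_M(X)+|Y\cap B|\}$ for $X\subseteq S$, $Y\subseteq T$; and the matroid union $G\vee H$ of matroids on a common set has as independent sets the unions of an independent set of $G$ and an independent set of $H$. -}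

module Defs where

open import Data.Nat using (ℕ; zero; suc; _+_; _⊔_; _⊓_; _<_)
open import Data.Bool using (true; false)
open import Data.Fin using (Fin)
open import Data.Fin.Subset using (Subset; _∈_; _∉_; _⊆_; _∪_; _∩_; _─_; ⁅_⁆; ∣_∣; ⊥; ∁)
open import Data.Fin.Subset.Properties using (_⊆?_)
open import Data.List using (List; []; _∷_; map; _++_; filter; foldr)
open import Data.Vec using (Vec; []; _∷_)
open import Data.Product using (Σ; ∃; _×_; _,_; ∃-syntax)
open import Relation.Nullary using (¬_; Dec)
open import Relation.Nullary.Decidable using (_×-dec_)
open import Relation.Binary.PropositionalEquality using (_≡_; _≢_)

-- Independence is required to be decidable (automatic
-- classically for finite sets); this lets us compute the rank function.
record Matroid (n : ℕ) : Set₁ where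
  field
    Indep      : Subset n → Set
    Indep?     : (I : Subset n) → Dec (Indep I)
    indep-∅    : Indep ⊥
    indep-⊆    : ∀ {I J} → J ⊆ I → Indep I → Indep J
    indep-aug  : ∀ {I J} → Indep I → Indep J → ∣ I ∣ < ∣ J ∣ →
                 ∃[ e ] (e ∈ J × e ∉ I × Indep (I ∪ ⁅ e ⁆))

open Matroid public

allSubsets : (n : ℕ) → List (Subset n)
allSubsets zero = [] ∷ []
allSubsets (suc n) = map (true ∷_) (allSubsets n) ++ map (false ∷_) (allSubsets n)

maximum : List ℕ → ℕ
maximum = foldr _⊔_ 0

rank : ∀ {n} → Matroid n → Subset n → ℕ
rank {n} M X = maximum (map ∣_∣ (filter (λ I → (I ⊆? X) ×-dec Indep? M I) (allSubsets n)))

IsCircuit : {P : Set} → (P → P → Set) → (P → Set) → P → Set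
IsCircuit _⊑_ Ind C = ¬ Ind C × (∀ D → D ⊑ C → D ≢ C → Ind D)

Circuit : ∀ {n} → Matroid n → Subset n → Set
Circuit M = IsCircuit _⊆_ (Indep M)

Cyclic : ∀ {n} → Matroid n → Subset n → Set
Cyclic {n} M Y = Σ (List (Subset n)) λ Cs →
  (∀ C → C Data.List.Membership.Propositional.∈ Cs → Circuit M C) × Y ≡ foldr _∪_ ⊥ Cs
  where import Data.List.Membership.Propositional

IsBasisOfRestr : ∀ {n} → Matroid n → Subset n → Subset n → Set
IsBasisOfRestr M Z Bs =
  Bs ⊆ Z × Indep M Bs × (∀ I → I ⊆ Z → Indep M I → Bs ⊆ I → I ≡ Bs)

ColoopOfRestr : ∀ {n} → Matroid n → Subset n → Fin n → Set
ColoopOfRestr M Z e = e ∈ Z × (∀ Bs → IsBasisOfRestr M Z Bs → e ∈ Bs)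

-- Ground set S ∪ T with S = Fin m, T = Fin n (disjoint by construction).
-- A subset of S ∪ T is a pair (X , Y) with X ⊆ S and Y ⊆ T, i.e. X ∪ Y.

Sub₂ : ℕ → ℕ → Set
Sub₂ m n = Subset m × Subset n

_⊆₂_ : ∀ {m n} → Sub₂ m n → Sub₂ m n → Set
(X , Y) ⊆₂ (X' , Y') = X ⊆ X' × Y ⊆ Y'

_∪₂_ : ∀ {m n} → Sub₂ m n → Sub₂ m n → Sub₂ m n
(X , Y) ∪₂ (X' , Y') = (X ∪ X' , Y ∪ Y')

-- independent sets of M⁺(A,B): Z independent iff r(Z) = |Z|, where
-- r(X ∪ Y) = min { r_M(X ∪ A), r_M(X) + |Y ∩ B| }
IndepPlus : ∀ {m n} → Matroid m → Subset m → Subset n → Sub₂ m n → Set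
IndepPlus M A B (X , Y) = rank M (X ∪ A) ⊓ (rank M X + ∣ Y ∩ B ∣) ≡ ∣ X ∣ + ∣ Y ∣

-- independent sets of N₀ = N ⊕ U_{0,S}
IndepN₀ : ∀ {m n} → Matroid n → Sub₂ m n → Set
IndepN₀ N (X , Y) = X ≡ ⊥ × Indep N Y

IndepUnion : ∀ {m n} → (Sub₂ m n → Set) → (Sub₂ m n → Set) → Sub₂ m n → Set
IndepUnion G H Z = ∃[ Z₁ ] ∃[ Z₂ ] (G Z₁ × H Z₂ × Z ≡ Z₁ ∪₂ Z₂)

IndepPrincipalSum : ∀ {m n} → Matroid m → Matroid n → Subset m → Subset n → Sub₂ m n → Set
IndepPrincipalSum M N A B = IndepUnion (IndepPlus M A B) (IndepN₀ N)

CircuitPrincipalSum : ∀ {m n} → Matroid m → Matroid n → Subset m → Subset n → Sub₂ m n → Set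
CircuitPrincipalSum M N A B = IsCircuit _⊆₂_ (IndepPrincipalSum M N A B)

module Submission where

-- The proof first trades the matroid-union description of independence for a
-- numerical one: (X , Y) is independent in (M,N;A,B) iff
--
--   (★)  X ∈ I(M),  Y − B ∈ I(N)  and  |X| + |Y| ≤ r_M(X ∪ A) + r_N(Y).
--
-- This rests on the independent sets of M⁺(A,B) (X ∈ I(M), Y ⊆ B and
-- |X| + |Y| ≤ r_M(X ∪ A)) and on the fact that the least size of a Y₁ ⊆ Y ∩ B
-- with Y − Y₁ ∈ I(N) is |Y| − r_N(Y).  The family (★) is closed under subsets,
-- so a set is a circuit iff it is dependent and all its one-element deletions
-- are independent.  For a circuit (X , Y) with Y ≠ ∅ and X ∪ (Y ∩ B) ≠ ∅ the
-- deletions make the inequality of (★) fail by exactly one, and then deleting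
-- e ∈ X − A or f ∈ Y must not lower r_M(X ∪ A), resp. r_N(Y).  In rank form
-- this says that e is not a coloop of M|(X ∪ A), resp. that Y is cyclic.  The
-- remaining circuits (Y = ∅, or X = ∅ and Y ∩ B = ∅) are those of M and N|(T − B).

open import Defs
open import Data.Nat using (ℕ; zero; suc; _+_; _≤_; _<_; s≤s; _≤?_)
open import Data.Nat.Properties
open import Data.Bool using (true; false)
open import Data.Fin using (Fin)
open import Data.Fin.Properties using (any?) renaming (_≟_ to _≟ᶠ_)
open import Data.Fin.Subset
  using (Subset; _∈_; _∉_; _⊆_; _∪_; _∩_; _─_; _-_; ⁅_⁆; ∣_∣; ⊥; ∁)
open import Data.Fin.Subset.Properties
open import Data.Vec using ([]; _∷_; here; there)
open import Data.List using (List; []; _∷_; map; filter; foldr; allFin)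
open import Data.List.Membership.Propositional using () renaming (_∈_ to _∈ˡ_)
open import Data.List.Membership.Propositional.Properties
  using (∈-map⁺; ∈-map⁻; ∈-filter⁺; ∈-filter⁻; ∈-++⁺ˡ; ∈-++⁺ʳ; ∈-allFin; foldr-selective)
open import Data.List.Properties using (foldr-preservesᵒ)
import Data.List.Relation.Unary.Any as Any
open import Data.Product using (∃-syntax; _×_; _,_; proj₁; proj₂)
open import Data.Sum using (_⊎_; inj₁; inj₂; [_,_])
open import Relation.Nullary using (¬_; Dec; yes; no; ¬?; contradiction)
open import Relation.Nullary.Decidable using (_×-dec_; decidable-stable)
open import Relation.Binary.PropositionalEquality
  using (_≡_; _≢_; refl; sym; trans; cong; cong₂; subst; module ≡-Reasoning)
open import Function.Bundles using (_⇔_; mk⇔; Equivalence)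
open import Function.Construct.Composition using (_⇔-∘_)
open import Function.Construct.Symmetry using (⇔-sym)
open import Algebra.Properties.CommutativeSemigroup +-commutativeSemigroup using (interchange)

private variable
  k : ℕ
  x y : Fin k
  p q r : Subset k

x∈p─q⁻ : x ∈ p ─ q → x ∈ p × x ∉ q
x∈p─q⁻ {p = p} {q = q} x∈ = p─q⊆p p q x∈ , outside p q x∈
  where
  outside : ∀ {k} {x : Fin k} (p q : Subset k) → x ∈ p ─ q → x ∉ q
  outside (true ∷ p) (false ∷ q) here ()
  outside (_ ∷ p) (_ ∷ q) (there x∈) (there x∈q) = outside p q x∈ x∈q

x∈p-y⁻ : x ∈ p - y → x ∈ p × x ≢ y
x∈p-y⁻ x∈ with x∈p─q⁻ x∈
... | x∈p , x∉⁅y⁆ = x∈p , x∉⁅y⁆⇒x≢y x∉⁅y⁆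

p-x≢p : x ∈ p → p - x ≢ p
p-x≢p {x = x} x∈p p-x≡p = proj₂ (x∈p-y⁻ (subst (x ∈_) (sym p-x≡p) x∈p)) refl

⊆-del : q ⊆ p → y ∉ q → q ⊆ p - y
⊆-del q⊆p y∉q x∈q = x∈p∧x≢y⇒x∈p-y (q⊆p x∈q) λ { refl → y∉q x∈q }

del-⊆ : p - y ⊆ q → y ∈ q → p ⊆ q
del-⊆ {y = y} p-y⊆q y∈q {x} x∈p with x ≟ᶠ y
... | yes refl = y∈q
... | no x≢y = p-y⊆q (x∈p∧x≢y⇒x∈p-y x∈p x≢y)

⊆-∪⁅⁆ : q ⊆ p ∪ ⁅ y ⁆ → y ∉ q → q ⊆ p
⊆-∪⁅⁆ {p = p} {y = y} q⊆ y∉q {x} x∈q with x∈p∪q⁻ p ⁅ y ⁆ (q⊆ x∈q)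
... | inj₁ x∈p = x∈p
... | inj₂ x∈⁅y⁆ = contradiction (subst (_∈ _) (x∈⁅y⁆⇒x≡y y x∈⁅y⁆) x∈q) y∉q

∪⁅⁆-⊆ : p ⊆ r → y ∈ r → p ∪ ⁅ y ⁆ ⊆ r
∪⁅⁆-⊆ {p = p} {y = y} p⊆r y∈r x∈ with x∈p∪q⁻ p ⁅ y ⁆ x∈
... | inj₁ x∈p = p⊆r x∈p
... | inj₂ x∈⁅y⁆ = subst (_∈ _) (sym (x∈⁅y⁆⇒x≡y y x∈⁅y⁆)) y∈r

─-monoˡ : p ⊆ q → p ─ r ⊆ q ─ r
─-monoˡ p⊆q x∈ with x∈p─q⁻ x∈
... | x∈p , x∉r = x∈p∧x∉q⇒x∈p─q (p⊆q x∈p) x∉r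

⊆∁⇒⊆─ : p ⊆ ∁ q → p ⊆ p ─ q
⊆∁⇒⊆─ p⊆∁q x∈p = x∈p∧x∉q⇒x∈p─q x∈p (x∈∁p⇒x∉p (p⊆∁q x∈p))

─-del-⊆ : y ∈ q → p ─ q ⊆ (p - y) ─ q
─-del-⊆ y∈q x∈ with x∈p─q⁻ x∈
... | x∈p , x∉q = x∈p∧x∉q⇒x∈p─q (x∈p∧x≢y⇒x∈p-y x∈p λ { refl → x∉q y∈q }) x∉q

∪─∪⊆─ : (p ∪ r) ─ (q ∪ r) ⊆ p ─ q
∪─∪⊆─ {p = p} {r = r} x∈ with x∈p─q⁻ x∈
... | x∈p∪r , x∉q∪r with x∈p∪q⁻ p r x∈p∪r
...   | inj₁ x∈p = x∈p∧x∉q⇒x∈p─q x∈p (λ x∈q → x∉q∪r (x∈p∪q⁺ (inj₁ x∈q)))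
...   | inj₂ x∈r = contradiction (x∈p∪q⁺ (inj₂ x∈r)) x∉q∪r

∪-del-⊆ : (p ∪ r) - y ⊆ (p - y) ∪ r
∪-del-⊆ {p = p} {r = r} x∈ with x∈p-y⁻ x∈
... | x∈p∪r , x≢y = [ (λ x∈p → x∈p∪q⁺ (inj₁ (x∈p∧x≢y⇒x∈p-y x∈p x≢y))) , (λ x∈r → x∈p∪q⁺ (inj₂ x∈r)) ]
                      (x∈p∪q⁻ p r x∈p∪r)

del-∪-⊆ : y ∉ r → (p - y) ∪ r ⊆ (p ∪ r) - y
del-∪-⊆ {r = r} {p = p} y∉r x∈ with x∈p∪q⁻ (p - _) r x∈
... | inj₁ x∈p-y = let x∈p , x≢y = x∈p-y⁻ x∈p-y in x∈p∧x≢y⇒x∈p-y (x∈p∪q⁺ (inj₁ x∈p)) x≢y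
... | inj₂ x∈r = x∈p∧x≢y⇒x∈p-y (x∈p∪q⁺ (inj₂ x∈r)) λ { refl → y∉r x∈r }

∪-⊆-del-∪ : y ∈ r → p ∪ r ⊆ (p - y) ∪ r
∪-⊆-del-∪ {y = y} y∈r {x} x∈ with x ≟ᶠ y
... | yes refl = x∈p∪q⁺ (inj₂ y∈r)
... | no x≢y = ∪-del-⊆ (x∈p∧x≢y⇒x∈p-y x∈ x≢y)

p─q∪q≡p : q ⊆ p → (p ─ q) ∪ q ≡ p
p─q∪q≡p {q = q} {p = p} q⊆p = ⊆-antisym
  (λ x∈ → [ (λ x∈p─q → proj₁ (x∈p─q⁻ x∈p─q)) , q⊆p ] (x∈p∪q⁻ (p ─ q) q x∈))
  p⊆p─q∪q
  where
  p⊆p─q∪q : p ⊆ (p ─ q) ∪ q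
  p⊆p─q∪q {x} x∈p with x ∈? q
  ... | yes x∈q = x∈p∪q⁺ (inj₂ x∈q)
  ... | no x∉q = x∈p∪q⁺ (inj₁ (x∈p∧x∉q⇒x∈p─q x∈p x∉q))

⊆⇒≡⊎missing : p ⊆ q → p ≡ q ⊎ ∃[ x ] (x ∈ q × x ∉ p)
⊆⇒≡⊎missing {p = p} {q = q} p⊆q with nonempty? (q ─ p)
... | yes (x , x∈q─p) = inj₂ (x , x∈p─q⁻ x∈q─p)
... | no nothingMissing = inj₁ (⊆-antisym p⊆q q⊆p)
  where
  q⊆p : q ⊆ p
  q⊆p {x} x∈q = decidable-stable (x ∈? p) λ x∉p → nothingMissing (x , x∈p∧x∉q⇒x∈p─q x∈q x∉p)

∣p∣≡∣p∩q∣+∣p─q∣ : (p q : Subset k) → ∣ p ∣ ≡ ∣ p ∩ q ∣ + ∣ p ─ q ∣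
∣p∣≡∣p∩q∣+∣p─q∣ [] [] = refl
∣p∣≡∣p∩q∣+∣p─q∣ (true ∷ p) (true ∷ q) = cong suc (∣p∣≡∣p∩q∣+∣p─q∣ p q)
∣p∣≡∣p∩q∣+∣p─q∣ (true ∷ p) (false ∷ q) =
  trans (cong suc (∣p∣≡∣p∩q∣+∣p─q∣ p q)) (sym (+-suc ∣ p ∩ q ∣ ∣ p ─ q ∣))
∣p∣≡∣p∩q∣+∣p─q∣ (false ∷ p) (true ∷ q) = ∣p∣≡∣p∩q∣+∣p─q∣ p q
∣p∣≡∣p∩q∣+∣p─q∣ (false ∷ p) (false ∷ q) = ∣p∣≡∣p∩q∣+∣p─q∣ p q

∣q∣+∣p─q∣≡∣p∣ : q ⊆ p → ∣ q ∣ + ∣ p ─ q ∣ ≡ ∣ p ∣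
∣q∣+∣p─q∣≡∣p∣ {q = q} {p = p} q⊆p = begin
  ∣ q ∣ + ∣ p ─ q ∣      ≡⟨ cong (λ s → ∣ s ∣ + ∣ p ─ q ∣) (sym p∩q≡q) ⟩
  ∣ p ∩ q ∣ + ∣ p ─ q ∣  ≡⟨ sym (∣p∣≡∣p∩q∣+∣p─q∣ p q) ⟩
  ∣ p ∣                  ∎
  where
  open ≡-Reasoning
  p∩q≡q : p ∩ q ≡ q
  p∩q≡q = ⊆-antisym (p∩q⊆q p q) (λ x∈q → x∈p∩q⁺ (q⊆p x∈q , x∈q))

∣p∣≤∣q∣+∣p─q∣ : (p q : Subset k) → ∣ p ∣ ≤ ∣ q ∣ + ∣ p ─ q ∣
∣p∣≤∣q∣+∣p─q∣ p q =
  ≤-trans (≤-reflexive (∣p∣≡∣p∩q∣+∣p─q∣ p q)) (+-monoˡ-≤ ∣ p ─ q ∣ (∣p∩q∣≤∣q∣ p q))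

suc∣p-x∣≡∣p∣ : x ∈ p → suc ∣ p - x ∣ ≡ ∣ p ∣
suc∣p-x∣≡∣p∣ {x = x} {p = p} x∈p =
  trans (cong (_+ ∣ p - x ∣) (sym (∣⁅x⁆∣≡1 x)))
        (∣q∣+∣p─q∣≡∣p∣ λ y∈⁅x⁆ → subst (_∈ p) (sym (x∈⁅y⁆⇒x≡y x y∈⁅x⁆)) x∈p)

∣p∪⁅x⁆∣≡suc∣p∣ : x ∉ p → ∣ p ∪ ⁅ x ⁆ ∣ ≡ suc ∣ p ∣
∣p∪⁅x⁆∣≡suc∣p∣ {x = x} {p = p} x∉p =
  trans (sym (suc∣p-x∣≡∣p∣ {p = p ∪ ⁅ x ⁆} (x∈p∪q⁺ (inj₂ (x∈⁅x⁆ x)))))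
        (cong (λ s → suc ∣ s ∣) (⊆-antisym p+x-x⊆p (⊆-del (p⊆p∪q _) x∉p)))
  where
  p+x-x⊆p : (p ∪ ⁅ x ⁆) - x ⊆ p
  p+x-x⊆p y∈ = let y∈p+x , y≢x = x∈p-y⁻ y∈ in
    [ (λ y∈p → y∈p) , (λ y∈⁅x⁆ → contradiction (x∈⁅y⁆⇒x≡y x y∈⁅x⁆) y≢x) ] (x∈p∪q⁻ p ⁅ x ⁆ y∈p+x)

⊆-card⇒≡ : p ⊆ q → ∣ q ∣ ≤ ∣ p ∣ → p ≡ q
⊆-card⇒≡ p⊆q ∣q∣≤∣p∣ with ⊆⇒≡⊎missing p⊆q
... | inj₁ p≡q = p≡q
... | inj₂ (x , x∈q , x∉p) = contradiction ∣q∣≤∣p∣ (<⇒≱ (p⊂q⇒∣p∣<∣q∣ (p⊆q , x , x∈q , x∉p)))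

∈⋃⁻ : (Cs : List (Subset k)) → x ∈ foldr _∪_ ⊥ Cs → ∃[ C ] (C ∈ˡ Cs × x ∈ C)
∈⋃⁻ [] x∈ = contradiction x∈ ∉⊥
∈⋃⁻ (C ∷ Cs) x∈ with x∈p∪q⁻ C (foldr _∪_ ⊥ Cs) x∈
... | inj₁ x∈C = C , Any.here refl , x∈C
... | inj₂ x∈⋃ = let D , D∈ , x∈D = ∈⋃⁻ Cs x∈⋃ in D , Any.there D∈ , x∈D

⊆⋃ : ∀ {C} (Cs : List (Subset k)) → C ∈ˡ Cs → C ⊆ foldr _∪_ ⊥ Cs
⊆⋃ (D ∷ Cs) (Any.here refl) x∈ = x∈p∪q⁺ (inj₁ x∈)
⊆⋃ (D ∷ Cs) (Any.there C∈) x∈ = x∈p∪q⁺ (inj₂ (⊆⋃ Cs C∈ x∈))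

∈-allSubsets : (I : Subset k) → I ∈ˡ allSubsets k
∈-allSubsets [] = Any.here refl
∈-allSubsets {suc k} (true ∷ I) = ∈-++⁺ˡ (∈-map⁺ (true ∷_) (∈-allSubsets I))
∈-allSubsets {suc k} (false ∷ I) =
  ∈-++⁺ʳ (map (true ∷_) (allSubsets k)) (∈-map⁺ (false ∷_) (∈-allSubsets I))

≤-maximum : ∀ {v vs} → v ∈ˡ vs → v ≤ maximum vs
≤-maximum {vs = vs} v∈ = foldr-preservesᵒ
  (λ a b → [ m≤n⇒m≤n⊔o b , m≤n⇒m≤o⊔n a ]) 0 vs (inj₂ (Any.map (λ { refl → ≤-refl }) v∈))

module RankTheory {k : ℕ} (M : Matroid k) where

  private
    candidate? : (X I : Subset k) → Dec (I ⊆ X × Indep M I)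
    candidate? X I = (I ⊆? X) ×-dec Indep? M I

  indep⇒≤rank : ∀ {I X} → Indep M I → I ⊆ X → ∣ I ∣ ≤ rank M X
  indep⇒≤rank {I} {X} iI I⊆X =
    ≤-maximum (∈-map⁺ ∣_∣ (∈-filter⁺ (candidate? X) (∈-allSubsets I) (I⊆X , iI)))

  rank-attained : ∀ X → ∃[ I ] (I ⊆ X × Indep M I × ∣ I ∣ ≡ rank M X)
  rank-attained X with foldr-selective ⊔-sel 0 (map ∣_∣ (filter (candidate? X) (allSubsets k)))
  ... | inj₁ r≡0 = ⊥ , ⊥⊆ , indep-∅ M , trans (∣⊥∣≡0 k) (sym r≡0)
  ... | inj₂ r∈ with ∈-map⁻ ∣_∣ r∈
  ...   | I , I∈ , r≡∣I∣ with ∈-filter⁻ (candidate? X) {xs = allSubsets k} I∈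
  ...     | _ , I⊆X , iI = I , I⊆X , iI , sym r≡∣I∣

  rank-mono : ∀ {X Y} → X ⊆ Y → rank M X ≤ rank M Y
  rank-mono {X} {Y} X⊆Y with rank-attained X
  ... | I , I⊆X , iI , ∣I∣≡r = subst (_≤ rank M Y) ∣I∣≡r (indep⇒≤rank iI λ x∈ → X⊆Y (I⊆X x∈))

  rank≤∣∣ : ∀ X → rank M X ≤ ∣ X ∣
  rank≤∣∣ X with rank-attained X
  ... | I , I⊆X , _ , ∣I∣≡r = subst (_≤ ∣ X ∣) ∣I∣≡r (p⊆q⇒∣p∣≤∣q∣ I⊆X)

  ∣∣≤rank⇒indep : ∀ {X} → ∣ X ∣ ≤ rank M X → Indep M X
  ∣∣≤rank⇒indep {X} ∣X∣≤r with rank-attained X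
  ... | I , I⊆X , iI , ∣I∣≡r =
    subst (Indep M) (⊆-card⇒≡ I⊆X (subst (∣ X ∣ ≤_) (sym ∣I∣≡r) ∣X∣≤r)) iI

  extend : ∀ {I X} → Indep M I → I ⊆ X → ∃[ J ] (I ⊆ J × J ⊆ X × Indep M J × ∣ J ∣ ≡ rank M X)
  extend {X = X} iI I⊆X = grow _ (m∸n+n≡m (indep⇒≤rank iI I⊆X)) iI I⊆X
    where
    -- induction on the gap d = r(X) − |I|, augmenting from a largest independent subset of X
    grow : ∀ {I} d → d + ∣ I ∣ ≡ rank M X → Indep M I → I ⊆ X →
           ∃[ J ] (I ⊆ J × J ⊆ X × Indep M J × ∣ J ∣ ≡ rank M X)
    grow {I} zero gap iI I⊆X = I , (λ x∈ → x∈) , I⊆X , iI , gap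
    grow {I} (suc d) gap iI I⊆X with rank-attained X
    ... | W , W⊆X , iW , ∣W∣≡r
        with indep-aug M iI iW (subst (∣ I ∣ <_) (trans gap (sym ∣W∣≡r)) (s≤s (m≤n+m ∣ I ∣ d)))
    ... | g , g∈W , g∉I , iI+g
        with grow d (trans (cong (d +_) (∣p∪⁅x⁆∣≡suc∣p∣ g∉I)) (trans (+-suc d ∣ I ∣) gap))
                    iI+g (∪⁅⁆-⊆ I⊆X (W⊆X g∈W))
    ... | J , I+g⊆J , J⊆X , iJ , ∣J∣≡r = J , (λ x∈ → I+g⊆J (x∈p∪q⁺ (inj₁ x∈))) , J⊆X , iJ , ∣J∣≡r

  rank≤rank+∣─∣ : ∀ Z W → rank M Z ≤ rank M W + ∣ Z ─ W ∣
  rank≤rank+∣─∣ Z W with rank-attained Z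
  ... | J , J⊆Z , iJ , ∣J∣≡r = begin
    rank M Z                ≡⟨ sym ∣J∣≡r ⟩
    ∣ J ∣                   ≡⟨ ∣p∣≡∣p∩q∣+∣p─q∣ J W ⟩
    ∣ J ∩ W ∣ + ∣ J ─ W ∣   ≤⟨ +-mono-≤ (indep⇒≤rank (indep-⊆ M (p∩q⊆p J W) iJ) (p∩q⊆q J W))
                                        (p⊆q⇒∣p∣≤∣q∣ (─-monoˡ {r = W} J⊆Z)) ⟩
    rank M W + ∣ Z ─ W ∣    ∎
    where open ≤-Reasoning

  dependent⇒circuit : ∀ {D} → ¬ Indep M D → ∃[ C ] (C ⊆ D × Circuit M C)
  dependent⇒circuit {D} dep = shrink ∣ D ∣ ≤-refl dep
    where
    -- delete elements as long as the set stays dependent; s bounds the size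
    shrink : ∀ {D} s → ∣ D ∣ ≤ s → ¬ Indep M D → ∃[ C ] (C ⊆ D × Circuit M C)
    shrink {D} s ∣D∣≤s dep with any? (λ g → (g ∈? D) ×-dec ¬? (Indep? M (D - g)))
    shrink {D} zero ∣D∣≤0 dep | yes (g , g∈D , _) =
      contradiction (subst (_≤ 0) (sym (suc∣p-x∣≡∣p∣ g∈D)) ∣D∣≤0) λ ()
    shrink {D} (suc s) ∣D∣≤s dep | yes (g , g∈D , dep-g)
        with shrink s (≤-pred (subst (_≤ suc s) (sym (suc∣p-x∣≡∣p∣ g∈D)) ∣D∣≤s)) dep-g
    ... | C , C⊆D-g , circ = C , (λ x∈ → proj₁ (x∈p-y⁻ (C⊆D-g x∈))) , circ
    shrink {D} s _ dep | no noDependentDeletion = D , (λ x∈ → x∈) , dep , minimal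
      where
      minimal : ∀ D' → D' ⊆ D → D' ≢ D → Indep M D'
      minimal D' D'⊆D D'≢D with ⊆⇒≡⊎missing D'⊆D
      ... | inj₁ D'≡D = contradiction D'≡D D'≢D
      ... | inj₂ (g , g∈D , g∉D') = indep-⊆ M (⊆-del D'⊆D g∉D')
              (decidable-stable (Indep? M (D - g)) λ dep-g → noDependentDeletion (g , g∈D , dep-g))

  circuit-through-new : ∀ {I C f} → Indep M I → Circuit M C → C ⊆ I ∪ ⁅ f ⁆ → f ∈ C
  circuit-through-new {f = f} iI (dep , _) C⊆ =
    decidable-stable (f ∈? _) λ f∉C → dep (indep-⊆ M (⊆-∪⁅⁆ C⊆ f∉C) iI)

  basis⇒∣∣≡rank : ∀ {Z Bs} → IsBasisOfRestr M Z Bs → ∣ Bs ∣ ≡ rank M Z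
  basis⇒∣∣≡rank {Z} (Bs⊆Z , iBs , maximal) with extend iBs Bs⊆Z
  ... | J , Bs⊆J , J⊆Z , iJ , ∣J∣≡r = subst (λ T → ∣ T ∣ ≡ rank M Z) (maximal J J⊆Z iJ Bs⊆J) ∣J∣≡r

  ¬coloop⇒rank : ∀ {Z e} → e ∈ Z → ¬ ColoopOfRestr M Z e → rank M Z ≤ rank M (Z - e)
  ¬coloop⇒rank {Z} {e} e∈Z ¬coloop with rank M Z ≤? rank M (Z - e)
  ... | yes r≤ = r≤
  ... | no r≰ = contradiction (e∈Z , inEveryBasis) ¬coloop
    where
    inEveryBasis : ∀ Bs → IsBasisOfRestr M Z Bs → e ∈ Bs
    inEveryBasis Bs basis@(Bs⊆Z , iBs , _) = decidable-stable (e ∈? Bs) λ e∉Bs →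
      r≰ (subst (_≤ rank M (Z - e)) (basis⇒∣∣≡rank basis) (indep⇒≤rank iBs (⊆-del Bs⊆Z e∉Bs)))

  rank⇒¬coloop : ∀ {Z e} → rank M Z ≤ rank M (Z - e) → ¬ ColoopOfRestr M Z e
  rank⇒¬coloop {Z} {e} r≤ (_ , inEveryBasis) with rank-attained (Z - e)
  ... | W , W⊆Z-e , iW , ∣W∣≡r = proj₂ (x∈p-y⁻ (W⊆Z-e (inEveryBasis W basis))) refl
    where
    W⊆Z : W ⊆ Z
    W⊆Z x∈ = proj₁ (x∈p-y⁻ (W⊆Z-e x∈))
    basis : IsBasisOfRestr M Z W
    basis = W⊆Z , iW , λ I I⊆Z iI W⊆I →
      sym (⊆-card⇒≡ W⊆I (≤-trans (indep⇒≤rank iI I⊆Z) (subst (rank M Z ≤_) (sym ∣W∣≡r) r≤)))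

  -- Deleting an element of a circuit inside Z keeps the rank of Z: extend
  -- C − f to a basis of M|Z; it cannot contain f, so it lies in Z − f.
  circuit⇒rank : ∀ {C Z f} → Circuit M C → C ⊆ Z → f ∈ C → rank M Z ≤ rank M (Z - f)
  circuit⇒rank {C} {Z} {f} (dep , minimal) C⊆Z f∈C
      with extend (minimal (C - f) (p─q⊆p C ⁅ f ⁆) (p-x≢p f∈C)) (λ x∈ → C⊆Z (proj₁ (x∈p-y⁻ x∈)))
  ... | J , C-f⊆J , J⊆Z , iJ , ∣J∣≡r = subst (_≤ rank M (Z - f)) ∣J∣≡r (indep⇒≤rank iJ (⊆-del J⊆Z f∉J))
    where
    f∉J : f ∉ J
    f∉J f∈J = dep (indep-⊆ M (del-⊆ C-f⊆J f∈J) iJ)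

  rank⇒dependent : ∀ {Z f K} → f ∈ Z → rank M Z ≤ rank M (Z - f) →
                   K ⊆ Z - f → ∣ K ∣ ≡ rank M (Z - f) → ¬ Indep M (K ∪ ⁅ f ⁆)
  rank⇒dependent {Z} {f} {K} f∈Z r≤ K⊆Z-f ∣K∣≡r iK+f = 1+n≰n (begin
    suc (rank M Z)        ≤⟨ s≤s r≤ ⟩
    suc (rank M (Z - f))  ≡⟨ cong suc (sym ∣K∣≡r) ⟩
    suc ∣ K ∣             ≡⟨ sym (∣p∪⁅x⁆∣≡suc∣p∣ (λ f∈K → proj₂ (x∈p-y⁻ (K⊆Z-f f∈K)) refl)) ⟩
    ∣ K ∪ ⁅ f ⁆ ∣          ≤⟨ indep⇒≤rank iK+f (∪⁅⁆-⊆ (λ x∈ → proj₁ (x∈p-y⁻ (K⊆Z-f x∈))) f∈Z) ⟩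
    rank M Z              ∎)
    where open ≤-Reasoning

  rank⇒circuit : ∀ {Z f} → f ∈ Z → rank M Z ≤ rank M (Z - f) →
                 ∃[ C ] (Circuit M C × C ⊆ Z × f ∈ C)
  rank⇒circuit {Z} {f} f∈Z r≤ with rank-attained (Z - f)
  ... | K , K⊆Z-f , iK , ∣K∣≡r with dependent⇒circuit (rank⇒dependent f∈Z r≤ K⊆Z-f ∣K∣≡r)
  ... | C , C⊆K+f , circ =
    C , circ , ⊆-trans C⊆K+f (∪⁅⁆-⊆ (λ x∈ → proj₁ (x∈p-y⁻ (K⊆Z-f x∈))) f∈Z) ,
    circuit-through-new iK circ C⊆K+f

  CoveredByCircuits : Subset k → Set
  CoveredByCircuits Z = ∀ {f} → f ∈ Z → ∃[ C ] (Circuit M C × C ⊆ Z × f ∈ C)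

  cyclic⇒covered : ∀ {Z} → Cyclic M Z → CoveredByCircuits Z
  cyclic⇒covered (Cs , circuits , refl) f∈Z with ∈⋃⁻ Cs f∈Z
  ... | C , C∈Cs , f∈C = C , circuits C C∈Cs , ⊆⋃ Cs C∈Cs , f∈C

  covered⇒cyclic : ∀ {Z} → CoveredByCircuits Z → Cyclic M Z
  covered⇒cyclic {Z} cover =
    circuitsAt (allFin k) , allCircuits (allFin k) ,
    ⊆-antisym (λ {x} x∈Z → covers (allFin k) (∈-allFin x) x∈Z) (inside (allFin k))
    where
    circuitsAt : List (Fin k) → List (Subset k)
    circuitsAt [] = []
    circuitsAt (f ∷ fs) with f ∈? Z
    ... | yes f∈Z = proj₁ (cover f∈Z) ∷ circuitsAt fs
    ... | no _ = circuitsAt fs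

    allCircuits : ∀ fs C → C ∈ˡ circuitsAt fs → Circuit M C
    allCircuits (f ∷ fs) C C∈ with f ∈? Z
    allCircuits (f ∷ fs) C (Any.here refl) | yes f∈Z = proj₁ (proj₂ (cover f∈Z))
    allCircuits (f ∷ fs) C (Any.there C∈) | yes f∈Z = allCircuits fs C C∈
    ... | no _ = allCircuits fs C C∈

    inside : ∀ fs → foldr _∪_ ⊥ (circuitsAt fs) ⊆ Z
    inside [] x∈ = contradiction x∈ ∉⊥
    inside (f ∷ fs) x∈ with f ∈? Z
    ... | yes f∈Z = [ proj₁ (proj₂ (proj₂ (cover f∈Z))) , inside fs ] (x∈p∪q⁻ _ _ x∈)
    ... | no _ = inside fs x∈

    covers : ∀ fs {x} → x ∈ˡ fs → x ∈ Z → x ∈ foldr _∪_ ⊥ (circuitsAt fs)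
    covers (f ∷ fs) x∈fs x∈Z with f ∈? Z
    covers (f ∷ fs) (Any.here refl) x∈Z | yes f∈Z = x∈p∪q⁺ (inj₁ (proj₂ (proj₂ (proj₂ (cover f∈Z)))))
    covers (f ∷ fs) (Any.there x∈fs) x∈Z | yes f∈Z = x∈p∪q⁺ (inj₂ (covers fs x∈fs x∈Z))
    covers (f ∷ fs) (Any.here refl) x∈Z | no f∉Z = contradiction x∈Z f∉Z
    covers (f ∷ fs) (Any.there x∈fs) x∈Z | no f∉Z = covers fs x∈fs x∈Z

  cyclic⇒rank : ∀ {Z f} → Cyclic M Z → f ∈ Z → rank M Z ≤ rank M (Z - f)
  cyclic⇒rank cyc f∈Z with cyclic⇒covered cyc f∈Z
  ... | C , circ , C⊆Z , f∈C = circuit⇒rank circ C⊆Z f∈C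

  rank⇒cyclic : ∀ {Z} → (∀ {f} → f ∈ Z → rank M Z ≤ rank M (Z - f)) → Cyclic M Z
  rank⇒cyclic keeps = covered⇒cyclic λ f∈Z → rank⇒circuit f∈Z (keeps f∈Z)

open RankTheory

squeeze : ∀ {a b x y} → a ≤ x → b ≤ y → x + y ≤ a + b → x ≤ a × y ≤ b
squeeze {a} {b} {x} {y} a≤x b≤y x+y≤a+b =
  +-cancelʳ-≤ y x a (≤-trans x+y≤a+b (+-monoʳ-≤ a b≤y)) ,
  +-cancelˡ-≤ x y b (≤-trans x+y≤a+b (+-monoˡ-≤ b a≤x))

IsCircuit-resp-⇔ : ∀ {P : Set} {_⊑_ : P → P → Set} {Ind Ind' : P → Set} →
                   (∀ Z → Ind Z ⇔ Ind' Z) → ∀ {Z} → IsCircuit _⊑_ Ind Z ⇔ IsCircuit _⊑_ Ind' Z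
IsCircuit-resp-⇔ {P} {_⊑_} {Ind} {Ind'} same =
  mk⇔ (transport {Ind} {Ind'} same) (transport {Ind'} {Ind} (λ Z → ⇔-sym (same Z)))
  where
  transport : ∀ {Ind Ind' : P → Set} →
              (∀ Z → Ind Z ⇔ Ind' Z) → ∀ {Z} → IsCircuit _⊑_ Ind Z → IsCircuit _⊑_ Ind' Z
  transport same {Z} (dep , minimal) =
    (λ iZ → dep (Equivalence.from (same Z) iZ)) ,
    λ D D⊑Z D≢Z → Equivalence.to (same D) (minimal D D⊑Z D≢Z)

DownClosed : ∀ {m n} → (Sub₂ m n → Set) → Set
DownClosed Ind = ∀ {Z Z'} → Z' ⊆₂ Z → Ind Z → Ind Z'

module _ {m n : ℕ} {Ind : Sub₂ m n → Set} where

  deletions⇒circuit : DownClosed Ind → ∀ {X Y} → ¬ Ind (X , Y) →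
                      (∀ {e} → e ∈ X → Ind (X - e , Y)) → (∀ {f} → f ∈ Y → Ind (X , Y - f)) →
                      IsCircuit _⊆₂_ Ind (X , Y)
  deletions⇒circuit closed {X} {Y} dep delX delY = dep , proper
    where
    proper : ∀ D → D ⊆₂ (X , Y) → D ≢ (X , Y) → Ind D
    proper (X' , Y') (X'⊆X , Y'⊆Y) D≢ with ⊆⇒≡⊎missing X'⊆X | ⊆⇒≡⊎missing Y'⊆Y
    ... | inj₂ (e , e∈X , e∉X') | _ = closed (⊆-del X'⊆X e∉X' , Y'⊆Y) (delX e∈X)
    ... | inj₁ _ | inj₂ (f , f∈Y , f∉Y') = closed (X'⊆X , ⊆-del Y'⊆Y f∉Y') (delY f∈Y)
    ... | inj₁ refl | inj₁ refl = contradiction refl D≢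

  circuit-delˡ : ∀ {X Y e} → IsCircuit _⊆₂_ Ind (X , Y) → e ∈ X → Ind (X - e , Y)
  circuit-delˡ {X} (_ , minimal) e∈X =
    minimal _ (p─q⊆p X _ , λ x∈ → x∈) (λ eq → p-x≢p e∈X (cong proj₁ eq))

  circuit-delʳ : ∀ {X Y f} → IsCircuit _⊆₂_ Ind (X , Y) → f ∈ Y → Ind (X , Y - f)
  circuit-delʳ {Y = Y} (_ , minimal) f∈Y =
    minimal _ ((λ x∈ → x∈) , p─q⊆p Y _) (λ eq → p-x≢p f∈Y (cong proj₂ eq))

indepPlus⇔ : ∀ {m n} (M : Matroid m) (A : Subset m) (B : Subset n) {X Y} →
             IndepPlus M A B (X , Y) ⇔ (Indep M X × Y ⊆ B × ∣ X ∣ + ∣ Y ∣ ≤ rank M (X ∪ A))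
indepPlus⇔ M A B {X} {Y} = mk⇔ to from
  where
  to : IndepPlus M A B (X , Y) → Indep M X × Y ⊆ B × ∣ X ∣ + ∣ Y ∣ ≤ rank M (X ∪ A)
  to min≡ = ∣∣≤rank⇒indep M (proj₁ tight) , Y⊆B , subst (_≤ rank M (X ∪ A)) min≡ (m⊓n≤m _ _)
    where
    -- the second term of the minimum can only reach |X| + |Y| if X and Y ∩ B are full
    tight : ∣ X ∣ ≤ rank M X × ∣ Y ∣ ≤ ∣ Y ∩ B ∣
    tight = squeeze (rank≤∣∣ M X) (∣p∩q∣≤∣p∣ Y B) (subst (_≤ rank M X + ∣ Y ∩ B ∣) min≡ (m⊓n≤n _ _))
    Y⊆B : Y ⊆ B
    Y⊆B x∈Y = proj₂ (x∈p∩q⁻ Y B (subst (_ ∈_) (sym (⊆-card⇒≡ (p∩q⊆p Y B) (proj₂ tight))) x∈Y))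
  from : Indep M X × Y ⊆ B × ∣ X ∣ + ∣ Y ∣ ≤ rank M (X ∪ A) → IndepPlus M A B (X , Y)
  from (iX , Y⊆B , bound) = trans (m≥n⇒m⊓n≡n (subst (_≤ rank M (X ∪ A)) (sym second≡) bound)) second≡
    where
    second≡ : rank M X + ∣ Y ∩ B ∣ ≡ ∣ X ∣ + ∣ Y ∣
    second≡ = cong₂ _+_ (≤-antisym (rank≤∣∣ M X) (indep⇒≤rank M iX (λ x∈ → x∈)))
                        (cong ∣_∣ (⊆-antisym (p∩q⊆p Y B) (λ x∈ → x∈p∩q⁺ (x∈ , Y⊆B x∈))))

module PrincipalSum {m n : ℕ} (M : Matroid m) (N : Matroid n) (A : Subset m) (B : Subset n) where

  SumIndep : Sub₂ m n → Set
  SumIndep (X , Y) = Indep M X × Indep N (Y ─ B) × ∣ X ∣ + ∣ Y ∣ ≤ rank M (X ∪ A) + rank N Y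

  -- (★) for the union of an M⁺(A,B)-independent (X , Y₁) and an N-independent Y₂:
  -- Y − B lies in Y₂, and Y − Y₁ ⊆ Y₂ is an independent subset of Y.
  plus∪indep⇒SumIndep : ∀ {X Y₁ Y₂} → IndepPlus M A B (X , Y₁) → Indep N Y₂ → SumIndep (X , Y₁ ∪ Y₂)
  plus∪indep⇒SumIndep {X} {Y₁} {Y₂} ip iY₂ with Equivalence.to (indepPlus⇔ M A B) ip
  ... | iX , Y₁⊆B , bound = iX , indep-⊆ N Y─B⊆Y₂ iY₂ , (begin
    ∣ X ∣ + ∣ Y ∣                    ≤⟨ +-monoʳ-≤ ∣ X ∣ (∣p∣≤∣q∣+∣p─q∣ Y Y₁) ⟩
    ∣ X ∣ + (∣ Y₁ ∣ + ∣ Y ─ Y₁ ∣)     ≡⟨ sym (+-assoc ∣ X ∣ ∣ Y₁ ∣ _) ⟩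
    ∣ X ∣ + ∣ Y₁ ∣ + ∣ Y ─ Y₁ ∣       ≤⟨ +-mono-≤ bound (indep⇒≤rank N (indep-⊆ N Y─Y₁⊆Y₂ iY₂) (p─q⊆p Y Y₁)) ⟩
    rank M (X ∪ A) + rank N Y       ∎)
    where
    open ≤-Reasoning
    Y : Subset n
    Y = Y₁ ∪ Y₂
    Y─Y₁⊆Y₂ : Y ─ Y₁ ⊆ Y₂
    Y─Y₁⊆Y₂ x∈ = let x∈Y , x∉Y₁ = x∈p─q⁻ x∈ in
      [ (λ x∈Y₁ → contradiction x∈Y₁ x∉Y₁) , (λ x∈Y₂ → x∈Y₂) ] (x∈p∪q⁻ Y₁ Y₂ x∈Y)
    Y─B⊆Y₂ : Y ─ B ⊆ Y₂
    Y─B⊆Y₂ x∈ = let x∈Y , x∉B = x∈p─q⁻ x∈ in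
      Y─Y₁⊆Y₂ (x∈p∧x∉q⇒x∈p─q x∈Y λ x∈Y₁ → x∉B (Y₁⊆B x∈Y₁))

  indep⇒SumIndep : ∀ {X Y} → IndepPrincipalSum M N A B (X , Y) → SumIndep (X , Y)
  indep⇒SumIndep ((X , Y₁) , (_ , Y₂) , ip , (refl , iY₂) , refl) =
    subst (λ X' → SumIndep (X' , Y₁ ∪ Y₂)) (sym (∪-identityʳ X)) (plus∪indep⇒SumIndep ip iY₂)

  -- Conversely, extend Y − B to a basis J of N|Y; then M⁺(A,B) can take Y − J ⊆ B.
  SumIndep⇒indep : ∀ {X Y} → SumIndep (X , Y) → IndepPrincipalSum M N A B (X , Y)
  SumIndep⇒indep {X} {Y} (iX , iY─B , bound) with extend N iY─B (p─q⊆p Y B)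
  ... | J , Y─B⊆J , J⊆Y , iJ , ∣J∣≡r =
    (X , Y ─ J) , (⊥ , J) , Equivalence.from (indepPlus⇔ M A B) (iX , Y─J⊆B , bound') , (refl , iJ) ,
    cong₂ _,_ (sym (∪-identityʳ X)) (sym (p─q∪q≡p J⊆Y))
    where
    Y─J⊆B : Y ─ J ⊆ B
    Y─J⊆B {x} x∈ = let x∈Y , x∉J = x∈p─q⁻ x∈ in
      decidable-stable (x ∈? B) λ x∉B → x∉J (Y─B⊆J (x∈p∧x∉q⇒x∈p─q x∈Y x∉B))
    bound' : ∣ X ∣ + ∣ Y ─ J ∣ ≤ rank M (X ∪ A)
    bound' = +-cancelʳ-≤ (rank N Y) _ _ (begin
      ∣ X ∣ + ∣ Y ─ J ∣ + rank N Y     ≡⟨ +-assoc ∣ X ∣ _ _ ⟩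
      ∣ X ∣ + (∣ Y ─ J ∣ + rank N Y)   ≡⟨ cong (∣ X ∣ +_) (+-comm ∣ Y ─ J ∣ _) ⟩
      ∣ X ∣ + (rank N Y + ∣ Y ─ J ∣)   ≡⟨ cong (λ j → ∣ X ∣ + (j + ∣ Y ─ J ∣)) (sym ∣J∣≡r) ⟩
      ∣ X ∣ + (∣ J ∣ + ∣ Y ─ J ∣)      ≡⟨ cong (∣ X ∣ +_) (∣q∣+∣p─q∣≡∣p∣ J⊆Y) ⟩
      ∣ X ∣ + ∣ Y ∣                    ≤⟨ bound ⟩
      rank M (X ∪ A) + rank N Y       ∎)
      where open ≤-Reasoning

  indep⇔SumIndep : ∀ Z → IndepPrincipalSum M N A B Z ⇔ SumIndep Z
  indep⇔SumIndep (X , Y) = mk⇔ indep⇒SumIndep SumIndep⇒indep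

  -- (★) is closed under subsets, since removing d elements lowers a rank by at most d.
  SumIndep-⊆ : DownClosed SumIndep
  SumIndep-⊆ {X , Y} {X' , Y'} (X'⊆X , Y'⊆Y) (iX , iY─B , bound) =
    indep-⊆ M X'⊆X iX , indep-⊆ N (─-monoˡ Y'⊆Y) iY─B , +-cancelʳ-≤ (dX + dY) _ _ (begin
      ∣ X' ∣ + ∣ Y' ∣ + (dX + dY)                 ≡⟨ interchange ∣ X' ∣ ∣ Y' ∣ dX dY ⟩
      (∣ X' ∣ + dX) + (∣ Y' ∣ + dY)               ≡⟨ cong₂ _+_ (∣q∣+∣p─q∣≡∣p∣ X'⊆X) (∣q∣+∣p─q∣≡∣p∣ Y'⊆Y) ⟩
      ∣ X ∣ + ∣ Y ∣                               ≤⟨ bound ⟩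
      rank M (X ∪ A) + rank N Y                   ≤⟨ +-mono-≤ rankX rankY ⟩
      (rank M (X' ∪ A) + dX) + (rank N Y' + dY)   ≡⟨ interchange (rank M (X' ∪ A)) dX (rank N Y') dY ⟩
      rank M (X' ∪ A) + rank N Y' + (dX + dY)     ∎)
    where
    open ≤-Reasoning
    dX dY : ℕ
    dX = ∣ X ─ X' ∣
    dY = ∣ Y ─ Y' ∣
    rankX : rank M (X ∪ A) ≤ rank M (X' ∪ A) + dX
    rankX = ≤-trans (rank≤rank+∣─∣ M (X ∪ A) (X' ∪ A))
                    (+-monoʳ-≤ _ (p⊆q⇒∣p∣≤∣q∣ (∪─∪⊆─ {p = X} {r = A} {q = X'})))
    rankY : rank N Y ≤ rank N Y' + dY
    rankY = rank≤rank+∣─∣ N Y Y'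

  indep×indep⇒SumIndep : ∀ {X Y} → Indep M X → Indep N Y → SumIndep (X , Y)
  indep×indep⇒SumIndep {X} {Y} iX iY = iX , indep-⊆ N (p─q⊆p Y B) iY ,
    +-mono-≤ (indep⇒≤rank M iX (p⊆p∪q A)) (indep⇒≤rank N iY (λ x∈ → x∈))

  size-delˡ : ∀ {X : Subset m} {Y : Subset n} {e} → e ∈ X → suc (∣ X - e ∣ + ∣ Y ∣) ≡ ∣ X ∣ + ∣ Y ∣
  size-delˡ {Y = Y} e∈X = cong (_+ ∣ Y ∣) (suc∣p-x∣≡∣p∣ e∈X)

  size-delʳ : ∀ {X : Subset m} {Y : Subset n} {f} → f ∈ Y → suc (∣ X ∣ + ∣ Y - f ∣) ≡ ∣ X ∣ + ∣ Y ∣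
  size-delʳ {X} f∈Y = trans (sym (+-suc ∣ X ∣ _)) (cong (∣ X ∣ +_) (suc∣p-x∣≡∣p∣ f∈Y))

  Circuit★ : Sub₂ m n → Set
  Circuit★ = IsCircuit _⊆₂_ SumIndep

  CircuitOfM : Subset m → Subset n → Set
  CircuitOfM X Y = Circuit M X × Y ≡ ⊥

  CircuitOfN∖B : Subset m → Subset n → Set
  CircuitOfN∖B X Y = X ≡ ⊥ × Circuit N Y × Y ⊆ ∁ B

  MixedCircuit : Subset m → Subset n → Set
  MixedCircuit X Y = (Indep M X × (∀ e → e ∈ X → e ∉ A → ¬ ColoopOfRestr M (X ∪ A) e))
                     × (Cyclic N Y × Indep N (Y ─ B))
                     × ∣ X ∣ + ∣ Y ∣ ≡ suc (rank M (X ∪ A) + rank N Y)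

  -- A circuit inside S is a circuit of M, since (X' , ∅) is independent iff X' is.
  circuit⇒circuitOfM : ∀ {X Y} → Circuit★ (X , Y) → Y ≡ ⊥ → Circuit M X
  circuit⇒circuitOfM (dep , minimal) refl =
    (λ iX → dep (indep×indep⇒SumIndep iX (indep-∅ N))) ,
    λ X' X'⊆X X'≢X → proj₁ (minimal (X' , ⊥) (X'⊆X , λ x∈ → x∈) (λ eq → X'≢X (cong proj₁ eq)))

  -- A circuit inside T − B is a circuit of N, since there (★) is N-independence.
  circuit⇒circuitOfN : ∀ {X Y} → Circuit★ (X , Y) → X ≡ ⊥ → Y ⊆ ∁ B → Circuit N Y
  circuit⇒circuitOfN (dep , minimal) refl Y⊆∁B =
    (λ iY → dep (indep×indep⇒SumIndep (indep-∅ M) iY)) ,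
    λ Y' Y'⊆Y Y'≢Y → indep-⊆ N (⊆∁⇒⊆─ (λ x∈ → Y⊆∁B (Y'⊆Y x∈)))
      (proj₁ (proj₂ (minimal (⊥ , Y') ((λ x∈ → x∈) , Y'⊆Y) (λ eq → Y'≢Y (cong proj₂ eq)))))

  -- Deleting f
  -- shows that (★) fails by exactly one; so every independent deletion has
  -- size r_M(X ∪ A) + r_N(Y), and deleting e ∈ X − A or g ∈ Y keeps the ranks.
  circuit⇒mixed : ∀ {X Y f} → Circuit★ (X , Y) → f ∈ Y → Indep N (Y ─ B) → MixedCircuit X Y
  circuit⇒mixed {X} {Y} {f} circ f∈Y iY─B = (iX , noColoop) , (rank⇒cyclic N keepsY , iY─B) , tight
    where
    R : ℕ
    R = rank M (X ∪ A) + rank N Y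
    iX : Indep M X
    iX = proj₁ (circuit-delʳ circ f∈Y)
    tight : ∣ X ∣ + ∣ Y ∣ ≡ suc R
    tight = ≤-antisym (begin
      ∣ X ∣ + ∣ Y ∣                          ≡⟨ sym (size-delʳ {X = X} f∈Y) ⟩
      suc (∣ X ∣ + ∣ Y - f ∣)                ≤⟨ s≤s (proj₂ (proj₂ (circuit-delʳ circ f∈Y))) ⟩
      suc (rank M (X ∪ A) + rank N (Y - f))  ≤⟨ s≤s (+-monoʳ-≤ (rank M (X ∪ A)) (rank-mono N (p─q⊆p Y _))) ⟩
      suc R                                  ∎)
      (≰⇒> λ ≤R → proj₁ circ (iX , iY─B , ≤R))
      where open ≤-Reasoning
    R≤ : ∀ {s R'} → suc s ≡ ∣ X ∣ + ∣ Y ∣ → s ≤ R' → R ≤ R'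
    R≤ {R' = R'} size s≤R' = subst (_≤ R') (suc-injective (trans size tight)) s≤R'
    noColoop : ∀ e → e ∈ X → e ∉ A → ¬ ColoopOfRestr M (X ∪ A) e
    noColoop e e∈X e∉A = rank⇒¬coloop M (begin
      rank M (X ∪ A)         ≤⟨ +-cancelʳ-≤ (rank N Y) _ _
                                  (R≤ (size-delˡ {Y = Y} e∈X) (proj₂ (proj₂ (circuit-delˡ circ e∈X)))) ⟩
      rank M ((X - e) ∪ A)   ≤⟨ rank-mono M (del-∪-⊆ e∉A) ⟩
      rank M ((X ∪ A) - e)   ∎)
      where open ≤-Reasoning
    keepsY : ∀ {g} → g ∈ Y → rank N Y ≤ rank N (Y - g)
    keepsY g∈Y = +-cancelˡ-≤ (rank M (X ∪ A)) _ _
      (R≤ (size-delʳ {X = X} g∈Y) (proj₂ (proj₂ (circuit-delʳ circ g∈Y))))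

  -- Sorting the circuits: Y = ∅ gives circuits of M; otherwise Y − B is
  -- independent (via a deletion from X or from Y ∩ B) unless X = ∅ and Y ⊆ T − B.
  circuit⇒cases : ∀ {X Y} → Circuit★ (X , Y) → CircuitOfM X Y ⊎ CircuitOfN∖B X Y ⊎ MixedCircuit X Y
  circuit⇒cases {X} {Y} circ with nonempty? Y
  ... | no Y-empty = inj₁ (circuit⇒circuitOfM circ (Empty-unique Y-empty) , Empty-unique Y-empty)
  ... | yes (f , f∈Y) with nonempty? X | nonempty? (Y ∩ B)
  ...   | yes (e , e∈X) | _ = inj₂ (inj₂ (circuit⇒mixed circ f∈Y (proj₁ (proj₂ (circuit-delˡ circ e∈X)))))
  ...   | no _ | yes (g , g∈Y∩B) = let g∈Y , g∈B = x∈p∩q⁻ Y B g∈Y∩B in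
    inj₂ (inj₂ (circuit⇒mixed circ f∈Y (indep-⊆ N (─-del-⊆ g∈B) (proj₁ (proj₂ (circuit-delʳ circ g∈Y))))))
  ...   | no X-empty | no Y∩B-empty =
    inj₂ (inj₁ (Empty-unique X-empty , circuit⇒circuitOfN circ (Empty-unique X-empty) Y⊆∁B , Y⊆∁B))
    where
    Y⊆∁B : Y ⊆ ∁ B
    Y⊆∁B x∈Y = x∉p⇒x∈∁p λ x∈B → Y∩B-empty (_ , x∈p∩q⁺ (x∈Y , x∈B))

  circuitOfM⇒circuit : ∀ {X} → Circuit M X → Circuit★ (X , ⊥)
  circuitOfM⇒circuit {X} (depX , minimalX) = deletions⇒circuit SumIndep-⊆
    (λ (iX , _) → depX iX)
    (λ e∈X → indep×indep⇒SumIndep (minimalX _ (p─q⊆p X _) (p-x≢p e∈X)) (indep-∅ N))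
    (λ f∈⊥ → contradiction f∈⊥ ∉⊥)

  circuitOfN⇒circuit : ∀ {Y} → Circuit N Y → Y ⊆ ∁ B → Circuit★ (⊥ , Y)
  circuitOfN⇒circuit {Y} (depY , minimalY) Y⊆∁B = deletions⇒circuit SumIndep-⊆
    (λ (_ , iY─B , _) → depY (indep-⊆ N (⊆∁⇒⊆─ Y⊆∁B) iY─B))
    (λ e∈⊥ → contradiction e∈⊥ ∉⊥)
    (λ f∈Y → indep×indep⇒SumIndep (indep-∅ M) (minimalY _ (p─q⊆p Y _) (p-x≢p f∈Y)))

  -- A mixed set fails (★) by its size condition, while each one-element
  -- deletion has r_M(X ∪ A) + r_N(Y) elements and keeps both ranks: for e ∈ A
  -- trivially, for e ∈ X − A since e is not a coloop, and for f ∈ Y since Y is cyclic.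
  mixed⇒circuit : ∀ {X Y} → MixedCircuit X Y → Circuit★ (X , Y)
  mixed⇒circuit {X} {Y} ((iX , noColoop) , (cyc , iY─B) , tight) =
    deletions⇒circuit SumIndep-⊆ dep delX delY
    where
    R : ℕ
    R = rank M (X ∪ A) + rank N Y
    dep : ¬ SumIndep (X , Y)
    dep (_ , _ , ≤R) = 1+n≰n (subst (_≤ R) tight ≤R)
    size≡R : ∀ {s} → suc s ≡ ∣ X ∣ + ∣ Y ∣ → s ≡ R
    size≡R size = suc-injective (trans size tight)
    keepsX : ∀ {e} → e ∈ X → rank M (X ∪ A) ≤ rank M ((X - e) ∪ A)
    keepsX {e} e∈X with e ∈? A
    ... | yes e∈A = rank-mono M (∪-⊆-del-∪ e∈A)
    ... | no e∉A = ≤-trans (¬coloop⇒rank M (x∈p∪q⁺ (inj₁ e∈X)) (noColoop e e∈X e∉A)) (rank-mono M ∪-del-⊆)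
    delX : ∀ {e} → e ∈ X → SumIndep (X - e , Y)
    delX {e} e∈X = indep-⊆ M (p─q⊆p X _) iX , iY─B ,
      subst (_≤ rank M ((X - e) ∪ A) + rank N Y) (sym (size≡R (size-delˡ {Y = Y} e∈X))) (+-monoˡ-≤ (rank N Y) (keepsX e∈X))
    delY : ∀ {f} → f ∈ Y → SumIndep (X , Y - f)
    delY {f} f∈Y = iX , indep-⊆ N (─-monoˡ (p─q⊆p Y _)) iY─B ,
      subst (_≤ rank M (X ∪ A) + rank N (Y - f)) (sym (size≡R (size-delʳ {X = X} f∈Y)))
            (+-monoʳ-≤ (rank M (X ∪ A)) (cyclic⇒rank N cyc f∈Y))

  cases⇒circuit : ∀ {X Y} → CircuitOfM X Y ⊎ CircuitOfN∖B X Y ⊎ MixedCircuit X Y → Circuit★ (X , Y)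
  cases⇒circuit (inj₁ (circM , refl)) = circuitOfM⇒circuit circM
  cases⇒circuit (inj₂ (inj₁ (refl , circN , Y⊆∁B))) = circuitOfN⇒circuit circN Y⊆∁B
  cases⇒circuit (inj₂ (inj₂ mixed)) = mixed⇒circuit mixed

theorem3p15 : ∀ {m n} (M : Matroid m) (N : Matroid n) (A : Subset m) (B : Subset n)
              (X : Subset m) (Y : Subset n) →
              CircuitPrincipalSum M N A B (X , Y) ⇔
                ((Circuit M X × Y ≡ ⊥)
                 ⊎ (X ≡ ⊥ × Circuit N Y × Y ⊆ ∁ B)
                 ⊎ ((Indep M X × (∀ e → e ∈ X → e ∉ A → ¬ ColoopOfRestr M (X ∪ A) e))
                    × (Cyclic N Y × Indep N (Y ─ B))
                    × ∣ X ∣ + ∣ Y ∣ ≡ suc (rank M (X ∪ A) + rank N Y)))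
theorem3p15 M N A B X Y =
  mk⇔ circuit⇒cases cases⇒circuit ⇔-∘ IsCircuit-resp-⇔ {_⊑_ = _⊆₂_} indep⇔SumIndep
  where open PrincipalSum M N A B
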